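{- Let ${\mathbf{R}_\mathbf{C}}$ be the HoTT reals, $A:{\mathbf{R}_\mathbf{C}}\to\mathcal{U}$ and $B:\prod_{u,v:{\mathbf{R}_\mathbf{C}}}A(u)\to A(v)\to\prod_{\varepsilon:\mathbf{Q}_+}(u\sim_\varepsilon v)\to\Omega$. Suppose given: - $f_{\mathsf{rat}}:\prod_{q:\mathbf{Q}}A(\mathsf{rat}(q))$; - $f_{\lim}:\prod_{x:\mathcal{C}_{{\mathbf{R}_\mathbf{C}}}}\mathcal{D}^x_A\to A(\lim(x))$; - $f_{\mathsf{eq}}$: for all $u,v:{\mathbf{R}_\mathbf{C}}$, $a:A(u)$, $b:A(v)$, $p:\forall(\varepsilon:\mathbf{Q}_+).\,u\sim_\varepsilon v$ such that $a\sim_\varepsilon b$ holds for all $\varepsilon:\mathbf{Q}_+$, a dependent path $a=^A_{\mathsf{eq}(u,v,p)}b$; - for all $q,r:\mathbf{Q}$, $\varepsilon:\mathbf{Q}_+$: $-\varepsilon<q-r<\varepsilon\to f_{\mathsf{rat}}(q)\sim_\varepsilon f_{\mathsf{rat}}(r)$; - for all $q:\mathbf{Q}$, $y:\mathcal{C}_{{\mathbf{R}_\mathbf{C}}}$, $b:\mathcal{D}^y_A$, $\delta,\varepsilon:\mathbf{Q}_+$: $\mathsf{rat}(q)\sim_\varepsilon y_\delta\to f_{\mathsf{rat}}(q)\sim_\varepsilon b_\delta\to f_{\mathsf{rat}}(q)\sim_{\varepsilon+\delta}f_{\lim}(y,b)$; - for all $x:\mathcal{C}_{{\mathbf{R}_\mathbf{C}}}$,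 $a:\mathcal{D}^x_A$, $r:\mathbf{Q}$, $\delta,\varepsilon:\mathbf{Q}_+$: $x_\delta\sim_\varepsilon\mathsf{rat}(r)\to a_\delta\sim_\varepsilon f_{\mathsf{rat}}(r)\to f_{\lim}(x,a)\sim_{\varepsilon+\delta}f_{\mathsf{rat}}(r)$; - for all $x,y:\mathcal{C}_{{\mathbf{R}_\mathbf{C}}}$, $a:\mathcal{D}^x_A$, $b:\mathcal{D}^y_A$, $\delta,\eta,\varepsilon:\mathbf{Q}_+$: $x_\delta\sim_\varepsilon y_\eta\to a_\delta\sim_\varepsilon b_\eta\to f_{\lim}(x,a)\sim_{\varepsilon+\delta+\eta}f_{\lim}(y,b)$. Then there are $f:\prod_{u:{\mathbf{R}_\mathbf{C}}}A(u)$ and $g:\prod_{u,v:{\mathbf{R}_\mathbf{C}}}\prod_{\varepsilon:\mathbf{Q}_+}\prod_{\zeta:u\sim_\varepsilon v}B(u,v,f(u),f(v),\varepsilon,\zeta)$ such that $f(\mathsf{rat}(q))=f_{\mathsf{rat}}(q)$ for all $q:\mathbf{Q}$ and $f(\lim(x))=f_{\lim}(x,(f,g)[x])$ for all $x:\mathcal{C}_{{\mathbf{R}_\mathbf{C}}}$, where $(f,g)[x]$ is the dependent Cauchy approximation $\varepsilon\mapsto f(x_\varepsilon)$ (a dependent Cauchy approximation by virtue of $g$).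
   Context: Univalent type theory with univalent universe $\mathcal{U}$, $\Omega$ the type of propositions, $\mathbf{Q}$ the rationals, $\mathbf{Q}_+=\sum_{q:\mathbf{Q}}(q>0)$. A premetric on a type $R$ is a relation $\sim:\mathbf{Q}_+\times R\times R\to\Omega$, written $u\sim_\varepsilon v$. A Cauchy approximation in $R$ is $x:\mathbf{Q}_+\to R$ with $\forall(\delta,\varepsilon:\mathbf{Q}_+).\,x_\delta\sim_{\delta+\varepsilon}x_\varepsilon$; $\mathcal{C}_R$ is the type of these. A Cauchy structure is a premetric space $R$ with maps $\mathsf{rat}:\mathbf{Q}\to R$, $\lim:\mathcal{C}_R\to R$, $\mathsf{eq}:\prod_{u,v:R}(\forall\varepsilon.\,u\sim_\varepsilon v)\to u=v$, satisfying: (i) $-\varepsilon<q-r<\varepsilon\to\mathsf{rat}(q)\sim_\varepsilon\mathsf{rat}(r)$; (ii) $\mathsf{rat}(q)\sim_\varepsilon y_\delta\to\mathsf{rat}(q)\sim_{\varepsilon+\delta}\lim(y)$; (iii) $x_\delta\sim_\varepsilon\mathsf{rat}(r)\to\lim(x)\sim_{\varepsilon+\delta}\mathsf{rat}(r)$; (iv) $x_\delta\sim_\varepsilon y_\eta\to\lim(x)\sim_{\varepsilon+\delta+\eta}\lim(y)$, for all rationals $q,r$, all $\varepsilon,\delta,\eta:\mathbf{Q}_+$ and $x,y:\mathcal{C}_R$. A morphism of Cauchy structures $R\to S$ is a map $f:R\to S$ with maps $u\sim_\varepsilon v\to f(u)\sim_\varepsilon f(v)$ such that $f$ preserves $\mathsf{rat}$,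 $\lim$ (applied to the image approximation) and $\mathsf{eq}$ (i.e. $\mathsf{ap}_f$ of $\mathsf{eq}(u,v,p)$ equals $\mathsf{eq}$ applied to the image closeness proofs). The HoTT reals ${\mathbf{R}_\mathbf{C}}$ is a homotopy-initial Cauchy structure: for every Cauchy structure $S$, the type of morphisms ${\mathbf{R}_\mathbf{C}}\to S$ is contractible. Given $A,B$, write $a\sim_\varepsilon b$ for $B(u,v,a,b,\varepsilon,\zeta)$ where $a:A(u)$, $b:A(v)$ and $\zeta:u\sim_\varepsilon v$ is the (unique) witness, which must be available in each use above. For $x:\mathcal{C}_{{\mathbf{R}_\mathbf{C}}}$, $\mathcal{D}^x_A$ is the type of dependent Cauchy approximations over $x$: $a:\prod_{\varepsilon:\mathbf{Q}_+}A(x_\varepsilon)$ with $\forall(\delta,\varepsilon:\mathbf{Q}_+).\,a_\delta\sim_{\delta+\varepsilon}a_\varepsilon$. For a path $p:x=y$ in a type $X$, a family $P:X\to\mathcal{U}$, $u:P(x)$, $v:P(y)$, the type of dependent paths $u=^P_p v$ is defined by path induction with $(u=^P_{\mathsf{refl}(x)}v):\equiv(u=_{P(x)}v)$. -}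

module Defs where

open import Data.Product using (Σ; Σ-syntax; _×_; _,_; proj₁; proj₂)
open import Data.Rational using (ℚ; 0ℚ; _<_; _-_; -_; positive)
import Data.Rational as ℚ
open import Data.Rational.Properties using (pos+pos⇒pos; positive⁻¹)
open import Level using (Level)
open import Relation.Binary.PropositionalEquality using (_≡_; refl; cong)

isProp : Set → Set
isProp X = (x y : X) → x ≡ y

isContr : ∀ {ℓ} → Set ℓ → Set ℓ
isContr X = Σ[ c ∈ X ] ((y : X) → c ≡ y)

PathOver : {X : Set} (P : X → Set) {x y : X} → x ≡ y → P x → P y → Set
PathOver P refl u v = u ≡ v

ℚ₊ : Set
ℚ₊ = Σ[ q ∈ ℚ ] (0ℚ < q)

infixl 6 _+₊_
_+₊_ : ℚ₊ → ℚ₊ → ℚ₊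
(p , hp) +₊ (q , hq) =
  (p ℚ.+ q) , positive⁻¹ (p ℚ.+ q)
                {{pos+pos⇒pos p {{positive hp}} q {{positive hq}}}}

record CauchyStructure : Set₁ where
  field
    Carrier : Set
    _∼[_]_  : Carrier → ℚ₊ → Carrier → Set
    ∼-prop  : ∀ u ε v → isProp (u ∼[ ε ] v)

  isCauchy : (ℚ₊ → Carrier) → Set
  isCauchy x = ∀ δ ε → x δ ∼[ δ +₊ ε ] x ε

  CauchyApprox : Set
  CauchyApprox = Σ[ x ∈ (ℚ₊ → Carrier) ] isCauchy x

  field
    rat : ℚ → Carrier
    lim : CauchyApprox → Carrier
    eq  : ∀ u v → (∀ ε → u ∼[ ε ] v) → u ≡ v
    rat-rat : ∀ q r ε → (- proj₁ ε) < q - r → q - r < proj₁ ε →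
              rat q ∼[ ε ] rat r
    rat-lim : ∀ q (y : CauchyApprox) ε δ →
              rat q ∼[ ε ] proj₁ y δ → rat q ∼[ ε +₊ δ ] lim y
    lim-rat : ∀ (x : CauchyApprox) r ε δ →
              proj₁ x δ ∼[ ε ] rat r → lim x ∼[ ε +₊ δ ] rat r
    lim-lim : ∀ (x y : CauchyApprox) ε δ η →
              proj₁ x δ ∼[ ε ] proj₁ y η → lim x ∼[ ε +₊ δ +₊ η ] lim y

open CauchyStructure

record Morphism (R S : CauchyStructure) : Set where
  field
    map     : Carrier R → Carrier S
    map-∼   : ∀ {u v ε} → _∼[_]_ R u ε v → _∼[_]_ S (map u) ε (map v)
    map-rat : ∀ q → map (rat R q) ≡ rat S q
    map-lim : ∀ (x : CauchyApprox R) →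
              map (lim R x) ≡
              lim S ((λ ε → map (proj₁ x ε)) , (λ δ ε → map-∼ (proj₂ x δ ε)))
    map-eq  : ∀ u v (p : ∀ ε → _∼[_]_ R u ε v) →
              cong map (eq R u v p) ≡ eq S (map u) (map v) (λ ε → map-∼ (p ε))

isHInitial : CauchyStructure → Set₁
isHInitial R = (S : CauchyStructure) → isContr (Morphism R S)

BFam : (R : CauchyStructure) → (Carrier R → Set) → Set₁
BFam R A = (u v : Carrier R) → A u → A v → (ε : ℚ₊) → _∼[_]_ R u ε v → Set

DepApprox : (R : CauchyStructure) (A : Carrier R → Set) → BFam R A →
            CauchyApprox R → Set
DepApprox R A B x =
  Σ[ a ∈ ((ε : ℚ₊) → A (proj₁ x ε)) ]
    (∀ δ ε → B (proj₁ x δ) (proj₁ x ε) (a δ) (a ε) (δ +₊ ε) (proj₂ x δ ε))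

module Submission where

-- The eliminator data (A, B, f-rat, f-lim, f-eq and the four closeness
-- clauses) is exactly a Cauchy structure "displayed" over R.  Its total
-- space  Σ u. A u, with  (u , a) ∼ε (v , b)  meaning  Σ (ζ : u ∼ε v). B(..,ζ),
-- is again a Cauchy structure, and  proj₁  is a morphism from it to R.
-- Initiality of R gives a morphism  h : R → Σ A.  Composing with  proj₁
-- gives an endomorphism of R which, by contractibility of  Morphism R R,
-- equals the identity.  The second components of  h  form a "section of A
-- over" this endomorphism (values, closeness proofs, and computation rules
-- as paths over the endomorphism's own rules); transporting the section
-- along the equality with the identity yields f, g and the computation rules
-- strictly, since over the identity every dependent path is an ordinary one.

open import Defs
open import Data.Product using (Σ; Σ-syntax; _×_; _,_; proj₁; proj₂)
open import Data.Rational using (ℚ; _<_; _-_; -_)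
open import Relation.Binary.PropositionalEquality
  using (_≡_; refl; cong; sym; trans; subst; module ≡-Reasoning)
open import Relation.Binary.PropositionalEquality.Properties using (cong-id; cong-∘)

isProp-Σ : {X : Set} {Y : X → Set} → isProp X → (∀ x → isProp (Y x)) →
           isProp (Σ X Y)
isProp-Σ pX pY (x , y) (x′ , y′) with pX x x′
... | refl = cong (x ,_) (pY x y y′)

isContr⇒≡ : ∀ {ℓ} {X : Set ℓ} → isContr X → (x y : X) → x ≡ y
isContr⇒≡ (c , contr) x y = trans (sym (contr x)) (contr y)

pair≡ : {X : Set} {A : X → Set} {u v : X} {a : A u} {b : A v}
        (e : u ≡ v) → PathOver A e a b → _≡_ {A = Σ X A} (u , a) (v , b)
pair≡ refl refl = refl

cong-proj₁-pair≡ : {X : Set} {A : X → Set} {u v : X} {a : A u} {b : A v}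
                   (e : u ≡ v) (d : PathOver A e a b) →
                   cong proj₁ (pair≡ {A = A} e d) ≡ e
cong-proj₁-pair≡ refl refl = refl

proj₂-over : {X : Set} {A : X → Set} {w w′ : Σ X A} (e : w ≡ w′) →
             PathOver A (cong proj₁ e) (proj₂ w) (proj₂ w′)
proj₂-over refl = refl

idMorphism : (R : CauchyStructure) → Morphism R R
idMorphism R = record
  { map     = λ u → u
  ; map-∼   = λ ζ → ζ
  ; map-rat = λ q → refl
  ; map-lim = λ x → refl
  ; map-eq  = λ u v p → cong-id (CauchyStructure.eq R u v p)
  }

record Displayed (R : CauchyStructure) : Set₁ where
  open CauchyStructure R
  field
    A      : Carrier → Set
    B      : BFam R A
    B-prop : ∀ u v a b ε ζ → isProp (B u v a b ε ζ)
    f-rat  : (q : ℚ) → A (rat q)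
    f-lim  : (x : CauchyApprox) → DepApprox R A B x → A (lim x)
    f-eq   : ∀ u v (a : A u) (b : A v) (p : ∀ ε → u ∼[ ε ] v) →
             (∀ ε → B u v a b ε (p ε)) → PathOver A (eq u v p) a b
    B-rat-rat : ∀ q r ε (h₁ : (- proj₁ ε) < q - r) (h₂ : q - r < proj₁ ε) →
      B (rat q) (rat r) (f-rat q) (f-rat r) ε (rat-rat q r ε h₁ h₂)
    B-rat-lim : ∀ q (y : CauchyApprox) (b : DepApprox R A B y) δ ε
      (ζ : rat q ∼[ ε ] proj₁ y δ) →
      B (rat q) (proj₁ y δ) (f-rat q) (proj₁ b δ) ε ζ →
      B (rat q) (lim y) (f-rat q) (f-lim y b) (ε +₊ δ) (rat-lim q y ε δ ζ)
    B-lim-rat : ∀ (x : CauchyApprox) (a : DepApprox R A B x) r δ ε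
      (ζ : proj₁ x δ ∼[ ε ] rat r) →
      B (proj₁ x δ) (rat r) (proj₁ a δ) (f-rat r) ε ζ →
      B (lim x) (rat r) (f-lim x a) (f-rat r) (ε +₊ δ) (lim-rat x r ε δ ζ)
    B-lim-lim : ∀ (x y : CauchyApprox) (a : DepApprox R A B x)
      (b : DepApprox R A B y) δ η ε (ζ : proj₁ x δ ∼[ ε ] proj₁ y η) →
      B (proj₁ x δ) (proj₁ y η) (proj₁ a δ) (proj₁ b η) ε ζ →
      B (lim x) (lim y) (f-lim x a) (f-lim y b) (ε +₊ δ +₊ η)
        (lim-lim x y ε δ η ζ)

module _ {R : CauchyStructure} (D : Displayed R) where
  open CauchyStructure R
  open Displayed D

  Total : CauchyStructure
  Total = record
    { Carrier = Σ Carrier A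
    ; _∼[_]_  = λ { (u , a) ε (v , b) → Σ (u ∼[ ε ] v) (B u v a b ε) }
    ; ∼-prop  = λ { (u , a) ε (v , b) →
                    isProp-Σ (∼-prop u ε v) (B-prop u v a b ε) }
    ; rat     = λ q → rat q , f-rat q
    ; lim     = λ { (w , c) →
        lim ((λ ε → proj₁ (w ε)) , (λ δ ε → proj₁ (c δ ε))) ,
        f-lim _ ((λ ε → proj₂ (w ε)) , (λ δ ε → proj₂ (c δ ε))) }
    ; eq      = λ { (u , a) (v , b) p →
        pair≡ (eq u v (λ ε → proj₁ (p ε)))
              (f-eq u v a b _ (λ ε → proj₂ (p ε))) }
    ; rat-rat = λ q r ε h₁ h₂ → rat-rat q r ε h₁ h₂ , B-rat-rat q r ε h₁ h₂
    ; rat-lim = λ { q _ ε δ (ζ , β) →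
        rat-lim q _ ε δ ζ , B-rat-lim q _ _ δ ε ζ β }
    ; lim-rat = λ { _ r ε δ (ζ , β) →
        lim-rat _ r ε δ ζ , B-lim-rat _ _ r δ ε ζ β }
    ; lim-lim = λ { _ _ ε δ η (ζ , β) →
        lim-lim _ _ ε δ η ζ , B-lim-lim _ _ _ _ δ η ε ζ β }
    }

  projectMorphism : Morphism R Total → Morphism R R
  projectMorphism h = record
    { map     = λ u → proj₁ (H.map u)
    ; map-∼   = λ ζ → proj₁ (H.map-∼ ζ)
    ; map-rat = λ q → cong proj₁ (H.map-rat q)
    ; map-lim = λ x → cong proj₁ (H.map-lim x)
    ; map-eq  = λ u v p → begin
        cong (λ u → proj₁ (H.map u)) (eq u v p)  ≡⟨ cong-∘ (eq u v p) ⟩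
        cong proj₁ (cong H.map (eq u v p))       ≡⟨ cong (cong proj₁) (H.map-eq u v p) ⟩
        cong proj₁ (CauchyStructure.eq Total (H.map u) (H.map v)
                      (λ ε → H.map-∼ (p ε)))     ≡⟨ cong-proj₁-pair≡ _ _ ⟩
        eq (proj₁ (H.map u)) (proj₁ (H.map v))
           (λ ε → proj₁ (H.map-∼ (p ε)))       ∎
    }
    where module H = Morphism h
          open ≡-Reasoning

  record SectionOver (m : Morphism R R) : Set where
    open Morphism m
    field
      s     : ∀ u → A (map u)
      s-∼   : ∀ {u v ε} (ζ : u ∼[ ε ] v) →
              B (map u) (map v) (s u) (s v) ε (map-∼ ζ)
      s-rat : ∀ q → PathOver A (map-rat q) (s (rat q)) (f-rat q)
      s-lim : ∀ x → PathOver A (map-lim x) (s (lim x))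
        (f-lim _ ((λ ε → s (proj₁ x ε)) , (λ δ ε → s-∼ (proj₂ x δ ε))))

  secondComponents : (h : Morphism R Total) → SectionOver (projectMorphism h)
  secondComponents h = record
    { s     = λ u → proj₂ (H.map u)
    ; s-∼   = λ ζ → proj₂ (H.map-∼ ζ)
    ; s-rat = λ q → proj₂-over (H.map-rat q)
    ; s-lim = λ x → proj₂-over (H.map-lim x)
    }
    where module H = Morphism h

  sectionOverId : isHInitial R → SectionOver (idMorphism R)
  sectionOverId init =
    subst SectionOver projection≡id (secondComponents h)
    where
    h : Morphism R Total
    h = proj₁ (init Total)
    projection≡id : projectMorphism h ≡ idMorphism R
    projection≡id = isContr⇒≡ (init R) _ _

theorem2p18 : (R : CauchyStructure) → isHInitial R →
    let open CauchyStructure R in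
    (A : Carrier → Set) (B : BFam R A) →
    (B-prop : ∀ u v a b ε ζ → isProp (B u v a b ε ζ)) →
    (f-rat : (q : ℚ) → A (rat q)) →
    (f-lim : (x : CauchyApprox) → DepApprox R A B x → A (lim x)) →
    (f-eq : ∀ u v (a : A u) (b : A v) (p : ∀ ε → u ∼[ ε ] v) →
            (∀ ε → B u v a b ε (p ε)) → PathOver A (eq u v p) a b) →
    (∀ q r ε (h₁ : (- proj₁ ε) < q - r) (h₂ : q - r < proj₁ ε) →
       B (rat q) (rat r) (f-rat q) (f-rat r) ε (rat-rat q r ε h₁ h₂)) →
    (∀ q (y : CauchyApprox) (b : DepApprox R A B y) δ ε
       (ζ : rat q ∼[ ε ] proj₁ y δ) →
       B (rat q) (proj₁ y δ) (f-rat q) (proj₁ b δ) ε ζ →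
       B (rat q) (lim y) (f-rat q) (f-lim y b) (ε +₊ δ) (rat-lim q y ε δ ζ)) →
    (∀ (x : CauchyApprox) (a : DepApprox R A B x) r δ ε
       (ζ : proj₁ x δ ∼[ ε ] rat r) →
       B (proj₁ x δ) (rat r) (proj₁ a δ) (f-rat r) ε ζ →
       B (lim x) (rat r) (f-lim x a) (f-rat r) (ε +₊ δ) (lim-rat x r ε δ ζ)) →
    (∀ (x y : CauchyApprox) (a : DepApprox R A B x) (b : DepApprox R A B y)
       δ η ε (ζ : proj₁ x δ ∼[ ε ] proj₁ y η) →
       B (proj₁ x δ) (proj₁ y η) (proj₁ a δ) (proj₁ b η) ε ζ →
       B (lim x) (lim y) (f-lim x a) (f-lim y b) (ε +₊ δ +₊ η)
         (lim-lim x y ε δ η ζ)) →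
    Σ[ f ∈ ((u : Carrier) → A u) ]
    Σ[ g ∈ ((u v : Carrier) (ε : ℚ₊) (ζ : u ∼[ ε ] v) →
             B u v (f u) (f v) ε ζ) ]
      ((∀ q → f (rat q) ≡ f-rat q) ×
       (∀ (x : CauchyApprox) →
          f (lim x) ≡
          f-lim x ((λ ε → f (proj₁ x ε)) ,
                   (λ δ ε → g (proj₁ x δ) (proj₁ x ε) (δ +₊ ε) (proj₂ x δ ε)))))
theorem2p18 R init A B B-prop f-rat f-lim f-eq rr rl lr ll =
  s , (λ u v ε ζ → s-∼ ζ) , s-rat , s-lim
  where
  D : Displayed R
  D = record
    { A = A ; B = B ; B-prop = B-prop
    ; f-rat = f-rat ; f-lim = f-lim ; f-eq = f-eq
    ; B-rat-rat = rr ; B-rat-lim = rl ; B-lim-rat = lr ; B-lim-lim = ll }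
  open SectionOver (sectionOverId D init)
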